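{- Let $R$ be a unary relation symbol. The sentence $\psi=\exists x\,\forall y\,Rx$ is preserved under extensions in $\mathbb{N}^\infty$, but there is no $\phi\in\Sigma_1$ with $\psi\equiv_{\mathbb{N}^\infty}\phi$.
   Context: $\mathbb{N}^\infty=(\mathbb{N}\cup\{\infty\},+,\cdot,0,1)$, naturally ordered by the usual order, with its natural infinitary sums and products (so that semantics is defined also on infinite universes). For a nonempty set $A$, $\mathrm{Lit}_A(\tau)$ is the set of literals $R\bar a,\neg R\bar a$ with $\bar a$ from $A$. An $\mathbb{N}^\infty$-interpretation over $A$ is $\pi:\mathrm{Lit}_A(\tau)\to\mathbb{N}\cup\{\infty\}$, model-defining if for each atom exactly one of $\pi(R\bar a),\pi(\neg R\bar a)$ is $0$; only model-defining ones are considered. First-order formulas with equality in negation normal form are evaluated by: literals via $\pi$; (in)equalities by Boolean value; $\vee$ by $+$, $\wedge$ by $\cdot$, $\exists x$ by the sum over $A$, $\forall x$ by the product over $A$. $\pi_A\subseteq\pi_B$ means $A\subseteq B$ and $\pi_A(L)=\pi_B(L)$ for literals over $A$; $\psi$ is preserved under extensions in $\mathbb{N}^\infty$ if $\pi_A[\![\psi]\!]\le\pi_B[\![\psi]\!]$ for all model-defining $\pi_A\subseteq\pi_B$. $\psi\equiv_{\mathbb{N}^\infty}\phi$ means $\pi[\![\psi]\!]=\pi[\![\phi]\!]$ for all model-defining $\mathbb{N}^\infty$-interpretations. $\Sigma_1$: sentences $\exists\bar x\,\phi(\bar x)$ with $\phi$ quantifier-free. -}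

module Defs where

open import Data.Nat as N using (ℕ; zero; suc)
open import Data.Fin using (Fin; zero; suc)
open import Data.List using (List; []; _∷_)
open import Data.List.Relation.Unary.Unique.Propositional using (Unique)
open import Data.Vec.Functional as V using (Vector)
open import Data.Product using (Σ; _×_; _,_)
open import Data.Sum using (_⊎_)
open import Relation.Nullary using (¬_)
open import Relation.Binary.PropositionalEquality using (_≡_; _≢_)
open import Function using (Injective)

data ℕ∞ : Set where
  fin : ℕ → ℕ∞
  ∞   : ℕ∞

0∞ 1∞ : ℕ∞
0∞ = fin 0
1∞ = fin 1

infixl 6 _+∞_
infixl 7 _*∞_
infix 4 _≤∞_

_+∞_ : ℕ∞ → ℕ∞ → ℕ∞
fin m +∞ fin n = fin (m N.+ n)
fin _ +∞ ∞     = ∞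
∞     +∞ _     = ∞

_*∞_ : ℕ∞ → ℕ∞ → ℕ∞
fin zero    *∞ _           = fin 0
fin (suc m) *∞ fin n       = fin (suc m N.* n)
fin (suc m) *∞ ∞           = ∞
∞           *∞ fin zero    = fin 0
∞           *∞ fin (suc n) = ∞
∞           *∞ ∞           = ∞

data _≤∞_ : ℕ∞ → ℕ∞ → Set where
  fin≤fin : ∀ {m n} → m N.≤ n → fin m ≤∞ fin n
  _≤∞∞    : ∀ x → x ≤∞ ∞

-- Natural infinitary sums and products over an arbitrary set A.
-- A finite sub-family is given by a duplicate-free list of indices.

sumL : {A : Set} → (A → ℕ∞) → List A → ℕ∞
sumL f []       = 0∞
sumL f (a ∷ as) = f a +∞ sumL f as

prodL : {A : Set} → (A → ℕ∞) → List A → ℕ∞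
prodL f []       = 1∞
prodL f (a ∷ as) = f a *∞ prodL f as

IsSupFin : {A : Set} → (List A → ℕ∞) → ℕ∞ → Set
IsSupFin {A} g v =
  ((l : List A) → Unique l → g l ≤∞ v) ×
  ((w : ℕ∞) → ((l : List A) → Unique l → g l ≤∞ w) → v ≤∞ w)

HasSum : {A : Set} → (A → ℕ∞) → ℕ∞ → Set
HasSum f v = IsSupFin (sumL f) v

HasProd : {A : Set} → (A → ℕ∞) → ℕ∞ → Set
HasProd {A} f v =
  (Σ A (λ a → (f a ≡ 0∞) × (v ≡ 0∞))) ⊎
  (((a : A) → f a ≢ 0∞) × IsSupFin (prodL f) v)

-- First-order formulas in negation normal form over τ = {R}, R unary,
-- with equality; variables are de Bruijn indices (Fin n).

data Fm (n : ℕ) : Set where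
  R    : Fin n → Fm n
  ¬R   : Fin n → Fm n
  eq   : Fin n → Fin n → Fm n
  neq  : Fin n → Fin n → Fm n
  _∨_  : Fm n → Fm n → Fm n
  _∧_  : Fm n → Fm n → Fm n
  ex   : Fm (suc n) → Fm n
  all  : Fm (suc n) → Fm n

data QF {n : ℕ} : Fm n → Set where
  qR   : ∀ i → QF (R i)
  q¬R  : ∀ i → QF (¬R i)
  qeq  : ∀ i j → QF (eq i j)
  qneq : ∀ i j → QF (neq i j)
  q∨   : ∀ {φ ψ} → QF φ → QF ψ → QF (φ ∨ ψ)
  q∧   : ∀ {φ ψ} → QF φ → QF ψ → QF (φ ∧ ψ)

data IsΣ₁ {n : ℕ} : Fm n → Set where
  qf  : ∀ {φ} → QF φ → IsΣ₁ φ
  ex₁ : ∀ {φ} → IsΣ₁ {suc n} φ → IsΣ₁ (ex φ)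

ExactlyOneZero : ℕ∞ → ℕ∞ → Set
ExactlyOneZero x y = (x ≡ 0∞ × y ≢ 0∞) ⊎ (x ≢ 0∞ × y ≡ 0∞)

record Interp : Set₁ where
  field
    A        : Set
    inhabit  : A
    pos      : A → ℕ∞
    neg      : A → ℕ∞
    modelDef : (a : A) → ExactlyOneZero (pos a) (neg a)

open Interp public

data Sem (I : Interp) : {n : ℕ} → Fm n → Vector (A I) n → ℕ∞ → Set where
  sR    : ∀ {n} {ρ : Vector (A I) n} i → Sem I (R i) ρ (pos I (ρ i))
  s¬R   : ∀ {n} {ρ : Vector (A I) n} i → Sem I (¬R i) ρ (neg I (ρ i))
  sEqT  : ∀ {n} {ρ : Vector (A I) n} i j → ρ i ≡ ρ j → Sem I (eq i j) ρ 1∞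
  sEqF  : ∀ {n} {ρ : Vector (A I) n} i j → ρ i ≢ ρ j → Sem I (eq i j) ρ 0∞
  sNeqT : ∀ {n} {ρ : Vector (A I) n} i j → ρ i ≢ ρ j → Sem I (neq i j) ρ 1∞
  sNeqF : ∀ {n} {ρ : Vector (A I) n} i j → ρ i ≡ ρ j → Sem I (neq i j) ρ 0∞
  s∨    : ∀ {n} {ρ : Vector (A I) n} {φ ψ v w} →
          Sem I φ ρ v → Sem I ψ ρ w → Sem I (φ ∨ ψ) ρ (v +∞ w)
  s∧    : ∀ {n} {ρ : Vector (A I) n} {φ ψ v w} →
          Sem I φ ρ v → Sem I ψ ρ w → Sem I (φ ∧ ψ) ρ (v *∞ w)
  s∃    : ∀ {n} {ρ : Vector (A I) n} {φ v} (f : A I → ℕ∞) →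
          ((a : A I) → Sem I φ (a V.∷ ρ) (f a)) → HasSum f v → Sem I (ex φ) ρ v
  s∀    : ∀ {n} {ρ : Vector (A I) n} {φ v} (f : A I → ℕ∞) →
          ((a : A I) → Sem I φ (a V.∷ ρ) (f a)) → HasProd f v → Sem I (all φ) ρ v

SentVal : Interp → Fm 0 → ℕ∞ → Set
SentVal I φ v = Sem I φ V.[] v

record _⊆I_ (I J : Interp) : Set where
  field
    ι      : A I → A J
    ι-inj  : Injective _≡_ _≡_ ι
    ι-pos  : (a : A I) → pos J (ι a) ≡ pos I a
    ι-neg  : (a : A I) → neg J (ι a) ≡ neg I a

PreservedUnderExt : Fm 0 → Set₁
PreservedUnderExt ψ =
  (I J : Interp) → I ⊆I J → (v w : ℕ∞) → SentVal I ψ v → SentVal J ψ w → v ≤∞ w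

_≡ℕ∞_ : Fm 0 → Fm 0 → Set₁
ψ ≡ℕ∞ φ = (I : Interp) (v w : ℕ∞) → SentVal I ψ v → SentVal I φ w → v ≡ w

-- ψ = ∃x ∀y R x   (inside ∀y the variable x has de Bruijn index 1)
ψ₀ : Fm 0
ψ₀ = ex (all (R (suc zero)))

-- Preservation: the summand of ψ at a witness a is the product over y of the constant
-- π(R a); it is either 0 already in the smaller interpretation, or nonzero in both,
-- and then every finite partial product of the smaller one reappears in the larger one.
--
-- No Σ₁ equivalent: on the interpretation over n + 1 points giving every positive
-- literal the value 1 + k and every negative one 0, ψ evaluates to (n + 1)(1 + k)^(n+1),
-- whereas a Σ₁ sentence with d literal occurrences evaluates to a polynomial in 1 + k
-- of degree at most d. Passing from k = 0 to k = 1 therefore multiplies the value of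
-- the sentence by at most 2^d but that of ψ by 2^(n+1); take n = d.
module Submission where

open import Defs
import Algebra.Properties.CommutativeSemigroup as CommutativeSemigroupProperties
open import Data.Empty using (⊥-elim)
open import Data.Fin using (Fin; zero; suc; _≟_)
open import Data.List using (List; []; _∷_; _++_; map; length; allFin)
open import Data.List.Membership.Propositional.Properties
  using (∈-∃++; ∈-++⁻; ∈-++⁺ˡ; ∈-++⁺ʳ; ∈-allFin)
open import Data.List.Properties using (length-map; length-tabulate)
open import Data.List.Relation.Binary.Subset.Propositional using (_⊆_)
import Data.List.Relation.Unary.All as All
open import Data.List.Relation.Unary.AllPairs using (_∷_)
open import Data.List.Relation.Unary.Any using (here; there)
open import Data.List.Relation.Unary.Unique.Propositional using (Unique)
open import Data.List.Relation.Unary.Unique.Propositional.Properties using (map⁺; allFin⁺)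
open import Data.Nat using (ℕ; zero; suc; _+_; _*_; _^_; _≤_; z≤n; NonZero)
open import Data.Nat.ListAction using (sum)
open import Data.Nat.Properties hiding (_≟_)
open import Data.Product using (Σ; _×_; _,_; proj₁; proj₂)
open import Data.Sum using (inj₁; inj₂)
open import Data.Vec.Functional as V using (Vector)
open import Function using (_∘_; const)
open import Relation.Nullary using (¬_; yes; no)
open import Relation.Binary.PropositionalEquality

open CommutativeSemigroupProperties +-commutativeSemigroup using (x∙yz≈y∙xz)
open CommutativeSemigroupProperties *-commutativeSemigroup using (interchange)

private
  variable
    X Y : Set

0∞-least : ∀ x → 0∞ ≤∞ x
0∞-least (fin n) = fin≤fin z≤n
0∞-least ∞       = 0∞ ≤∞∞

≤∞-trans : ∀ {x y z} → x ≤∞ y → y ≤∞ z → x ≤∞ z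
≤∞-trans {x} _           (_ ≤∞∞)     = x ≤∞∞
≤∞-trans     (fin≤fin p) (fin≤fin q) = fin≤fin (≤-trans p q)

+∞-mono-≤∞ : ∀ {x x′ y y′} → x ≤∞ x′ → y ≤∞ y′ → x +∞ y ≤∞ x′ +∞ y′
+∞-mono-≤∞ (fin≤fin p) (fin≤fin q) = fin≤fin (+-mono-≤ p q)
+∞-mono-≤∞ (fin≤fin _) (_ ≤∞∞)     = _ ≤∞∞
+∞-mono-≤∞ (_ ≤∞∞)     _           = _ ≤∞∞

fin-injective : ∀ {m n} → fin m ≡ fin n → m ≡ n
fin-injective refl = refl

fin-*∞ : ∀ m n → fin m *∞ fin n ≡ fin (m * n)
fin-*∞ zero    n = refl
fin-*∞ (suc m) n = refl

sumL-map-mono : (ι : X → Y) {f : X → ℕ∞} {g : Y → ℕ∞} →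
                (∀ a → f a ≤∞ g (ι a)) → ∀ l → sumL f l ≤∞ sumL g (map ι l)
sumL-map-mono ι f≤g []      = 0∞-least _
sumL-map-mono ι f≤g (a ∷ l) = +∞-mono-≤∞ (f≤g a) (sumL-map-mono ι f≤g l)

prodL-const : {f : X → ℕ∞} {g : Y → ℕ∞} {c : ℕ∞} →
              (∀ a → f a ≡ c) → (∀ b → g b ≡ c) →
              ∀ l l′ → length l ≡ length l′ → prodL f l ≡ prodL g l′
prodL-const f≡c g≡c []      []       _   = refl
prodL-const f≡c g≡c (a ∷ l) (b ∷ l′) |l| =
  cong₂ _*∞_ (trans (f≡c a) (sym (g≡c b))) (prodL-const f≡c g≡c l l′ (suc-injective |l|))

Sem-R⁻¹ : ∀ {I n} {ρ : Vector (A I) n} {i v} → Sem I (R i) ρ v → v ≡ pos I (ρ i)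
Sem-R⁻¹ (sR i) = refl

Sem-ex⁻¹ : ∀ {I n} {ρ : Vector (A I) n} {φ v} → Sem I (ex φ) ρ v →
           Σ (A I → ℕ∞) λ f → ((a : A I) → Sem I φ (a V.∷ ρ) (f a)) × HasSum f v
Sem-ex⁻¹ (s∃ f sem sum) = f , sem , sum

Sem-all⁻¹ : ∀ {I n} {ρ : Vector (A I) n} {φ v} → Sem I (all φ) ρ v →
            Σ (A I → ℕ∞) λ f → ((a : A I) → Sem I φ (a V.∷ ρ) (f a)) × HasProd f v
Sem-all⁻¹ (s∀ f sem prod) = f , sem , prod

module _ {I J : Interp} (I⊆J : I ⊆I J) where
  open _⊆I_ I⊆J

  ∀R-mono : (a : A I) {u u′ : ℕ∞} →
            Sem I (all (R (suc zero))) (a V.∷ V.[]) u →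
            Sem J (all (R (suc zero))) (ι a V.∷ V.[]) u′ → u ≤∞ u′
  ∀R-mono a semI semJ with Sem-all⁻¹ semI | Sem-all⁻¹ semJ
  ... | _ , _ , inj₁ (_ , _ , u≡0) | _ = subst (_≤∞ _) (sym u≡0) (0∞-least _)
  ... | f , semf , inj₂ (f≢0 , _) | g , semg , inj₁ (b , gb≡0 , _) =
    ⊥-elim (f≢0 a (trans (Sem-R⁻¹ (semf a))
                   (trans (sym (ι-pos a)) (trans (sym (Sem-R⁻¹ (semg b))) gb≡0))))
  ... | f , semf , inj₂ (_ , supf) | g , semg , inj₂ (_ , supg) =
    proj₂ supf _ λ l l! →
      subst (_≤∞ _)
        (prodL-const (λ b → trans (Sem-R⁻¹ (semg b)) (ι-pos a)) (Sem-R⁻¹ ∘ semf)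
                     (map ι l) l (length-map ι l))
        (proj₁ supg (map ι l) (map⁺ ι-inj l!))

  ψ₀-mono : ∀ {v w} → SentVal I ψ₀ v → SentVal J ψ₀ w → v ≤∞ w
  ψ₀-mono semI semJ with Sem-ex⁻¹ semI | Sem-ex⁻¹ semJ
  ... | f , semf , supf | g , semg , supg =
    proj₂ supf _ λ l l! →
      ≤∞-trans (sumL-map-mono ι (λ a → ∀R-mono a (semf a) (semg (ι a))) l)
               (proj₁ supg (map ι l) (map⁺ ι-inj l!))

ψ₀-preservedUnderExt : PreservedUnderExt ψ₀
ψ₀-preservedUnderExt I J I⊆J _ _ = ψ₀-mono I⊆J

sum-map-insert : (g : X → ℕ) (xs ys : List X) (a : X) →
                 sum (map g (xs ++ a ∷ ys)) ≡ g a + sum (map g (xs ++ ys))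
sum-map-insert g []       ys a = refl
sum-map-insert g (x ∷ xs) ys a =
  trans (cong (g x +_) (sum-map-insert g xs ys a)) (x∙yz≈y∙xz (g x) (g a) _)

sum-map-mono-⊆ : (g : X → ℕ) {l L : List X} → Unique l → l ⊆ L →
                 sum (map g l) ≤ sum (map g L)
sum-map-mono-⊆ g {[]}    _          _   = z≤n
sum-map-mono-⊆ g {a ∷ l} (a∉l ∷ l!) l⊆L with ∈-∃++ (l⊆L (here refl))
... | xs , ys , refl = begin
  g a + sum (map g l)              ≤⟨ +-monoʳ-≤ (g a) (sum-map-mono-⊆ g l! l⊆xs++ys) ⟩
  g a + sum (map g (xs ++ ys))     ≡⟨ sum-map-insert g xs ys a ⟨
  sum (map g (xs ++ a ∷ ys))       ∎
  where
  open ≤-Reasoning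
  l⊆xs++ys : l ⊆ xs ++ ys
  l⊆xs++ys x∈l with ∈-++⁻ xs (l⊆L (there x∈l))
  ... | inj₁ x∈xs         = ∈-++⁺ˡ x∈xs
  ... | inj₂ (here refl)  = ⊥-elim (All.lookup a∉l x∈l refl)
  ... | inj₂ (there x∈ys) = ∈-++⁺ʳ xs x∈ys

sum-map-const : (c : ℕ) (l : List X) → sum (map (const c) l) ≡ length l * c
sum-map-const c []      = refl
sum-map-const c (a ∷ l) = cong (c +_) (sum-map-const c l)

sum-map-≤-* : {g h : X → ℕ} (c : ℕ) → (∀ a → g a ≤ c * h a) →
              ∀ l → sum (map g l) ≤ c * sum (map h l)
sum-map-≤-* c g≤ch []      = z≤n
sum-map-≤-* {h = h} c g≤ch (a ∷ l) =
  ≤-trans (+-mono-≤ (g≤ch a) (sum-map-≤-* c g≤ch l))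
          (≤-reflexive (sym (*-distribˡ-+ c (h a) (sum (map h l)))))

sumL-fin : (g : X → ℕ) (l : List X) → sumL (fin ∘ g) l ≡ fin (sum (map g l))
sumL-fin g []      = refl
sumL-fin g (a ∷ l) = cong (fin (g a) +∞_) (sumL-fin g l)

prodL-fin-const : (m : ℕ) (l : List X) → prodL (const (fin m)) l ≡ fin (m ^ length l)
prodL-fin-const m []      = refl
prodL-fin-const m (a ∷ l) = trans (cong (fin m *∞_) (prodL-fin-const m l)) (fin-*∞ m _)

module _ {n : ℕ} where

  length-allFin : length (allFin n) ≡ n
  length-allFin = length-tabulate (λ i → i)

  sum-map-≤-allFin : (g : Fin n → ℕ) {l : List (Fin n)} → Unique l →
                     sum (map g l) ≤ sum (map g (allFin n))
  sum-map-≤-allFin g l! = sum-map-mono-⊆ g l! (λ {i} _ → ∈-allFin i)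

  Unique⇒length≤ : {l : List (Fin n)} → Unique l → length l ≤ n
  Unique⇒length≤ {l} l! = begin
    length l                         ≡⟨ sym (*-identityʳ _) ⟩
    length l * 1                     ≡⟨ sum-map-const 1 l ⟨
    sum (map (const 1) l)            ≤⟨ sum-map-≤-allFin (const 1) l! ⟩
    sum (map (const 1) (allFin n))   ≡⟨ sum-map-const 1 (allFin n) ⟩
    length (allFin n) * 1            ≡⟨ *-identityʳ _ ⟩
    length (allFin n)                ≡⟨ length-allFin ⟩
    n                                ∎
    where open ≤-Reasoning

  Fin-HasSum : (g : Fin n → ℕ) → HasSum (fin ∘ g) (fin (sum (map g (allFin n))))
  Fin-HasSum g =
    (λ l l! → subst (_≤∞ _) (sym (sumL-fin g l)) (fin≤fin (sum-map-≤-allFin g l!))) ,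
    (λ w ub → subst (_≤∞ w) (sumL-fin g (allFin n)) (ub (allFin n) (allFin⁺ n)))

  Fin-HasProd-const : (k : ℕ) → HasProd (λ (_ : Fin n) → fin (suc k)) (fin (suc k ^ n))
  Fin-HasProd-const k = inj₂ ((λ _ ()) , upper , least)
    where
    upper : ∀ l → Unique l → prodL (const (fin (suc k))) l ≤∞ fin (suc k ^ n)
    upper l l! = subst (_≤∞ _) (sym (prodL-fin-const (suc k) l))
                       (fin≤fin (^-monoʳ-≤ (suc k) (Unique⇒length≤ l!)))
    least : ∀ w → (∀ l → Unique l → prodL (const (fin (suc k))) l ≤∞ w) → fin (suc k ^ n) ≤∞ w
    least w ub = subst (_≤∞ w)
                       (trans (prodL-fin-const (suc k) (allFin n)) (cong (fin ∘ (suc k ^_)) length-allFin))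
                       (ub (allFin n) (allFin⁺ n))

literals : ∀ {m} → Fm m → ℕ
literals (R _)     = 1
literals (¬R _)    = 1
literals (eq _ _)  = 0
literals (neq _ _) = 0
literals (φ ∨ ψ)   = literals φ + literals ψ
literals (φ ∧ ψ)   = literals φ + literals ψ
literals (ex φ)    = literals φ
literals (all φ)   = literals φ

module ConstantInterp (n : ℕ) where

  interp : ℕ → Interp
  interp k = record
    { A = Fin (suc n) ; inhabit = zero
    ; pos = const (fin (suc k)) ; neg = const 0∞
    ; modelDef = λ _ → inj₂ ((λ ()) , refl)
    }

  -- Correct on Σ₁ formulas only; the clause for `all` is junk.
  value : ∀ {m} → ℕ → Fm m → Vector (Fin (suc n)) m → ℕ
  value k (R _)     ρ = suc k
  value k (¬R _)    ρ = 0
  value k (eq i j)  ρ with ρ i ≟ ρ j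
  ... | yes _ = 1
  ... | no _  = 0
  value k (neq i j) ρ with ρ i ≟ ρ j
  ... | yes _ = 0
  ... | no _  = 1
  value k (φ ∨ ψ)   ρ = value k φ ρ + value k ψ ρ
  value k (φ ∧ ψ)   ρ = value k φ ρ * value k ψ ρ
  value k (ex φ)    ρ = sum (map (λ a → value k φ (a V.∷ ρ)) (allFin (suc n)))
  value k (all φ)   ρ = 0

  QF-sem : ∀ {m} k {φ : Fm m} → QF φ → (ρ : Vector (Fin (suc n)) m) →
           Sem (interp k) φ ρ (fin (value k φ ρ))
  QF-sem k (qR i)     ρ = sR i
  QF-sem k (q¬R i)    ρ = s¬R i
  QF-sem k (qeq i j)  ρ with ρ i ≟ ρ j
  ... | yes p = sEqT i j p
  ... | no ¬p = sEqF i j ¬p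
  QF-sem k (qneq i j) ρ with ρ i ≟ ρ j
  ... | yes p = sNeqF i j p
  ... | no ¬p = sNeqT i j ¬p
  QF-sem k (q∨ p q)   ρ = s∨ (QF-sem k p ρ) (QF-sem k q ρ)
  QF-sem k {φ ∧ ψ} (q∧ p q) ρ =
    subst (Sem (interp k) (φ ∧ ψ) ρ) (fin-*∞ (value k φ ρ) (value k ψ ρ))
          (s∧ (QF-sem k p ρ) (QF-sem k q ρ))

  Σ₁-sem : ∀ {m} k {φ : Fm m} → IsΣ₁ φ → (ρ : Vector (Fin (suc n)) m) →
           Sem (interp k) φ ρ (fin (value k φ ρ))
  Σ₁-sem k (qf q)         ρ = QF-sem k q ρ
  Σ₁-sem k {ex φ} (ex₁ p) ρ =
    s∃ (λ a → fin (value k φ (a V.∷ ρ))) (λ a → Σ₁-sem k p (a V.∷ ρ)) (Fin-HasSum _)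

  ψ₀-sem : ∀ k → SentVal (interp k) ψ₀ (fin (suc n * suc k ^ suc n))
  ψ₀-sem k =
    subst (SentVal (interp k) ψ₀)
          (cong fin (trans (sum-map-const c (allFin (suc n))) (cong (_* c) (length-allFin {suc n}))))
          (s∃ (const (fin c)) (λ _ → s∀ _ (λ _ → sR (suc zero)) (Fin-HasProd-const k))
              (Fin-HasSum (const c)))
    where c = suc k ^ suc n

  -- As a function of the value 1 + k of the positive literals, the value of φ is a
  -- polynomial with coefficients in ℕ of degree at most literals φ.
  value-≤ : ∀ {m} k (φ : Fm m) (ρ : Vector (Fin (suc n)) m) →
            value k φ ρ ≤ suc k ^ literals φ * value 0 φ ρ
  value-≤ k (R _)     ρ = ≤-reflexive (sym (trans (*-identityʳ (suc k ^ 1)) (*-identityʳ (suc k))))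
  value-≤ k (¬R _)    ρ = z≤n
  value-≤ k (eq i j)  ρ with ρ i ≟ ρ j
  ... | yes _ = ≤-refl
  ... | no _  = z≤n
  value-≤ k (neq i j) ρ with ρ i ≟ ρ j
  ... | yes _ = z≤n
  ... | no _  = ≤-refl
  value-≤ k (φ ∨ ψ)   ρ = begin
    value k φ ρ + value k ψ ρ
      ≤⟨ +-mono-≤ (≤-trans (value-≤ k φ ρ) (weaken (m≤m+n (literals φ) (literals ψ)) _))
                  (≤-trans (value-≤ k ψ ρ) (weaken (m≤n+m (literals ψ) (literals φ)) _)) ⟩
    K * value 0 φ ρ + K * value 0 ψ ρ
      ≡⟨ *-distribˡ-+ K (value 0 φ ρ) (value 0 ψ ρ) ⟨
    K * (value 0 φ ρ + value 0 ψ ρ) ∎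
    where
    open ≤-Reasoning
    K = suc k ^ (literals φ + literals ψ)
    weaken : ∀ {d e} → d ≤ e → ∀ x → suc k ^ d * x ≤ suc k ^ e * x
    weaken d≤e x = *-monoˡ-≤ x (^-monoʳ-≤ (suc k) d≤e)
  value-≤ k (φ ∧ ψ)   ρ = begin
    value k φ ρ * value k ψ ρ
      ≤⟨ *-mono-≤ (value-≤ k φ ρ) (value-≤ k ψ ρ) ⟩
    (suc k ^ literals φ * value 0 φ ρ) * (suc k ^ literals ψ * value 0 ψ ρ)
      ≡⟨ interchange (suc k ^ literals φ) (value 0 φ ρ) (suc k ^ literals ψ) (value 0 ψ ρ) ⟩
    (suc k ^ literals φ * suc k ^ literals ψ) * (value 0 φ ρ * value 0 ψ ρ)
      ≡⟨ cong (_* _) (^-distribˡ-+-* (suc k) (literals φ) (literals ψ)) ⟨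
    suc k ^ (literals φ + literals ψ) * (value 0 φ ρ * value 0 ψ ρ) ∎
    where open ≤-Reasoning
  value-≤ k (ex φ)    ρ =
    sum-map-≤-* (suc k ^ literals φ) (λ a → value-≤ k φ (a V.∷ ρ)) (allFin (suc n))
  value-≤ k (all φ)   ρ = z≤n

m*2^[1+d]≰2^d*m : ∀ m d .{{_ : NonZero m}} → ¬ (m * 2 ^ suc d ≤ 2 ^ d * m)
m*2^[1+d]≰2^d*m m d m*2^[1+d]≤2^d*m = <⇒≱ (m<m*n P 2 ≤-refl) (begin
  P * 2             ≡⟨ *-comm P 2 ⟩
  2 * (2 ^ d * m)   ≡⟨ *-assoc 2 (2 ^ d) m ⟨
  2 ^ suc d * m     ≡⟨ *-comm (2 ^ suc d) m ⟩
  m * 2 ^ suc d     ≤⟨ m*2^[1+d]≤2^d*m ⟩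
  P                 ∎)
  where
  open ≤-Reasoning
  P = 2 ^ d * m
  instance
    P≢0 : NonZero P
    P≢0 = m*n≢0 (2 ^ d) m {{m^n≢0 2 d}}

no-Σ₁-equivalent : ¬ Σ (Fm 0) (λ φ → IsΣ₁ φ × (ψ₀ ≡ℕ∞ φ))
no-Σ₁-equivalent (φ , φ∈Σ₁ , ψ₀≡φ) = m*2^[1+d]≰2^d*m (suc d) d (begin
  suc d * 2 ^ suc d      ≡⟨ agree 1 ⟨
  value 1 φ V.[]         ≤⟨ value-≤ 1 φ V.[] ⟩
  2 ^ d * value 0 φ V.[] ≡⟨ cong (2 ^ d *_) (trans (agree 0) (cong (suc d *_) (^-zeroˡ (suc d)))) ⟩
  2 ^ d * (suc d * 1)    ≡⟨ cong (2 ^ d *_) (*-identityʳ (suc d)) ⟩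
  2 ^ d * suc d          ∎)
  where
  open ≤-Reasoning
  d = literals φ
  open ConstantInterp d
  agree : ∀ k → value k φ V.[] ≡ suc d * suc k ^ suc d
  agree k = fin-injective (sym (ψ₀≡φ (interp k) _ _ (ψ₀-sem k) (Σ₁-sem k φ∈Σ₁ V.[])))

mainTheorem4 : PreservedUnderExt ψ₀ × ¬ (Σ (Fm 0) (λ φ → IsΣ₁ φ × (ψ₀ ≡ℕ∞ φ)))
mainTheorem4 = ψ₀-preservedUnderExt , no-Σ₁-equivalent
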